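{- Every finite simple graph $G$ with independence number $\alpha(G)\le 2$ is perfectly divisible.
   Context: A graph is perfect if every induced subgraph $H$ satisfies $\chi(H)=\omega(H)$ ($\omega$ = clique number). A graph $H$ admits a perfect division if $V(H)$ can be partitioned into $A$ and $B$ with $H[A]$ perfect and $\omega(H[B])<\omega(H)$; $G$ is perfectly divisible if every induced subgraph of $G$ admits a perfect division. -}

module Defs where

open import Data.Nat using (ℕ; _<_; _≤_)
open import Data.Fin using (Fin)
open import Data.Bool using (Bool; true; false)
open import Data.Product using (Σ; ∃; _×_; _,_)
open import Relation.Nullary using (¬_; Dec)
open import Relation.Binary.PropositionalEquality using (_≡_; _≢_)
open import Function.Definitions using (Injective)

record Graph (n : ℕ) : Set₁ where
  field
    Adj   : Fin n → Fin n → Set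
    adj?  : ∀ u v → Dec (Adj u v)
    sym   : ∀ {u v} → Adj u v → Adj v u
    irrefl : ∀ {u} → ¬ Adj u u
open Graph public

-- Vertex subsets (these determine induced subgraphs of G).
VSet : ℕ → Set
VSet n = Fin n → Bool

_∈_ : ∀ {n} → Fin n → VSet n → Set
v ∈ S = S v ≡ true

_⊆_ : ∀ {n} → VSet n → VSet n → Set
S ⊆ T = ∀ v → v ∈ S → v ∈ T

NonEmpty : ∀ {n} → VSet n → Set
NonEmpty S = ∃ λ v → v ∈ S

full : ∀ {n} → VSet n
full _ = true

module _ {n : ℕ} (G : Graph n) where

  IsClique : VSet n → (k : ℕ) → (Fin k → Fin n) → Set
  IsClique S k f = Injective _≡_ _≡_ f × (∀ i → f i ∈ S)
                   × (∀ i j → i ≢ j → Adj G (f i) (f j))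

  HasClique : VSet n → ℕ → Set
  HasClique S k = Σ (Fin k → Fin n) (IsClique S k)

  IsCliqueNumber : VSet n → ℕ → Set
  IsCliqueNumber S k = HasClique S k × (∀ m → HasClique S m → m ≤ k)

  IsIndependentSet : (k : ℕ) → (Fin k → Fin n) → Set
  IsIndependentSet k f = Injective _≡_ _≡_ f
                         × (∀ i j → ¬ Adj G (f i) (f j))

  IndependenceNumber≤ : ℕ → Set
  IndependenceNumber≤ a = ∀ k f → IsIndependentSet k f → k ≤ a

  Colouring : VSet n → ℕ → Set
  Colouring S k = Σ ((v : Fin n) → v ∈ S → Fin k) λ c →
    ∀ u v (u∈ : u ∈ S) (v∈ : v ∈ S) → Adj G u v → c u u∈ ≢ c v v∈

  IsChromaticNumber : VSet n → ℕ → Set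
  IsChromaticNumber S k = Colouring S k × (∀ m → Colouring S m → k ≤ m)

  Perfect : VSet n → Set
  Perfect S = ∀ T → T ⊆ S → ∀ k → IsCliqueNumber T k → IsChromaticNumber T k

  PerfectDivision : VSet n → Set
  PerfectDivision S = Σ (VSet n) λ P →
    let A = λ v → S v Data.Bool.∧ P v
        B = λ v → S v Data.Bool.∧ Data.Bool.not (P v)
    in Perfect A × (∀ a b → IsCliqueNumber B a → IsCliqueNumber S b → a < b)

  PerfectlyDivisible : Set
  PerfectlyDivisible = ∀ S → NonEmpty S → PerfectDivision S

{-# OPTIONS --safe #-}
-- Fix a vertex v of S, and split S into the non-neighbours A of v (v included)
-- and the neighbours B of v. Adding v to a clique of G[B] gives a larger
-- clique of G[S], so ω(G[B]) < ω(G[S]). Since α(G) ≤ 2, any two distinct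
-- vertices of A other than v are adjacent, so each induced subgraph of G[A]
-- is a clique together with at most one isolated vertex v; colouring the clique
-- injectively and v with any colour already used shows it is perfect.
module Submission where

open import Defs hiding (sym)
open import Data.Nat using (ℕ; zero; suc; _≤_; _<_; s≤s)
open import Data.Fin using (Fin; zero; suc; inject≤) renaming (_≟_ to _≟F_)
open import Data.Fin.Properties using (injective⇒≤; inject≤-injective)
open import Data.Bool using (true; false; _∧_; not) renaming (_≟_ to _≟B_)
open import Data.Product using (_×_; _,_; proj₁; proj₂)
open import Data.Empty using (⊥; ⊥-elim)
open import Relation.Nullary using (¬_; Dec; yes; no)
open import Relation.Nullary.Decidable using (⌊_⌋)
open import Relation.Binary.PropositionalEquality
  using (_≡_; _≢_; refl; sym; trans; cong; subst)
open import Function.Definitions using (Injective)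
open import Data.List using (List; []; _∷_; length; filter; allFin; lookup)
open import Data.List.Relation.Unary.All as All using ([]; _∷_)
open import Data.List.Relation.Unary.AllPairs using ([]; _∷_)
open import Data.List.Relation.Unary.Any as Any using ()
open import Data.List.Relation.Unary.Any.Properties using (lookup-index)
open import Data.List.Relation.Unary.Unique.Propositional using (Unique)
import Data.List.Relation.Unary.Unique.Propositional.Properties as Unique
import Data.List.Membership.Propositional as Membership
open import Data.List.Membership.Propositional.Properties
  using (∈-lookup; ∈-filter⁺; ∈-filter⁻; ∈-allFin)

lookup-injective : ∀ {A : Set} {xs : List A} → Unique xs → Injective _≡_ _≡_ (lookup xs)
lookup-injective {xs = _ ∷ _} _          {zero}  {zero}  _  = refl
lookup-injective {xs = _ ∷ _} (x∉ ∷ _)   {zero}  {suc j} eq = ⊥-elim (All.lookup x∉ (∈-lookup j) eq)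
lookup-injective {xs = _ ∷ _} (x∉ ∷ _)   {suc i} {zero}  eq = ⊥-elim (All.lookup x∉ (∈-lookup i) (sym eq))
lookup-injective {xs = _ ∷ _} (_ ∷ uniq) {suc i} {suc j} eq = cong suc (lookup-injective uniq eq)

members : ∀ {n} → VSet n → List (Fin n)
members {n} T = filter (λ u → T u ≟B true) (allFin n)

members-unique : ∀ {n} (T : VSet n) → Unique (members T)
members-unique {n} T = Unique.filter⁺ (λ u → T u ≟B true) (Unique.allFin⁺ n)

∈-members⁺ : ∀ {n} {T : VSet n} {u} → u ∈ T → u Membership.∈ members T
∈-members⁺ {T = T} u∈T = ∈-filter⁺ (λ u → T u ≟B true) (∈-allFin _) u∈T

∈-members⁻ : ∀ {n} {T : VSet n} {u} → u Membership.∈ members T → u ∈ T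
∈-members⁻ {n} {T} u∈ = proj₂ (∈-filter⁻ (λ u → T u ≟B true) {xs = allFin n} u∈)

_∖_ : ∀ {n} → VSet n → Fin n → VSet n
(T ∖ v) u = T u ∧ not ⌊ u ≟F v ⌋

∖-⊆ : ∀ {n} (T : VSet n) v → (T ∖ v) ⊆ T
∖-⊆ T v u u∈ with T u
... | true  = refl
... | false = u∈

∈-∖⁺ : ∀ {n} {T : VSet n} {u v} → u ∈ T → u ≢ v → u ∈ (T ∖ v)
∈-∖⁺ {u = u} {v} u∈T u≢v rewrite u∈T with u ≟F v
... | yes u≡v = ⊥-elim (u≢v u≡v)
... | no  _   = refl

∈-∖⁻ : ∀ {n} {T : VSet n} {u v} → u ∈ (T ∖ v) → u ≢ v
∈-∖⁻ {T = T} {u} u∈ refl with T u | u ≟F u | u∈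
... | true  | no u≢u | _  = u≢u refl
... | true  | yes _  | ()
... | false | _      | ()

module _ {n : ℕ} (G : Graph n) where

  HasClique-mono : ∀ {S T k} → S ⊆ T → HasClique G S k → HasClique G T k
  HasClique-mono S⊆T (f , f-inj , f∈S , f-adj) = f , f-inj , (λ i → S⊆T _ (f∈S i)) , f-adj

  singleton-clique : ∀ {T v} → v ∈ T → HasClique G T 1
  singleton-clique v∈T = (λ _ → _) , (λ { {zero} {zero} _ → refl }) , (λ _ → v∈T)
                       , λ { zero zero 0≢0 → ⊥-elim (0≢0 refl) }

  extend-clique : ∀ {S B v a} → v ∈ S → (∀ u → u ∈ B → u ∈ S × Adj G v u) →
                  HasClique G B a → HasClique G S (suc a)
  extend-clique {S} {v = v} v∈S apex (f , f-inj , f∈B , f-adj) = g , g-inj , g∈S , g-adj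
    where
    g : Fin (suc _) → Fin n
    g zero    = v
    g (suc i) = f i
    v≢f : ∀ i → v ≢ f i
    v≢f i eq = irrefl G (subst (Adj G v) (sym eq) (proj₂ (apex _ (f∈B i))))
    g-inj : Injective _≡_ _≡_ g
    g-inj {zero}  {zero}  _  = refl
    g-inj {zero}  {suc j} eq = ⊥-elim (v≢f j eq)
    g-inj {suc i} {zero}  eq = ⊥-elim (v≢f i (sym eq))
    g-inj {suc i} {suc j} eq = cong suc (f-inj eq)
    g∈S : ∀ i → g i ∈ S
    g∈S zero    = v∈S
    g∈S (suc i) = proj₁ (apex _ (f∈B i))
    g-adj : ∀ i j → i ≢ j → Adj G (g i) (g j)
    g-adj zero    zero    0≢0 = ⊥-elim (0≢0 refl)
    g-adj zero    (suc j) _   = proj₂ (apex _ (f∈B j))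
    g-adj (suc i) zero    _   = Graph.sym G (proj₂ (apex _ (f∈B i)))
    g-adj (suc i) (suc j) i≢j = f-adj i j (λ eq → i≢j (cong suc eq))

  clique≤colours : ∀ {T k m} → HasClique G T k → Colouring G T m → k ≤ m
  clique≤colours {k = k} (f , _ , f∈T , f-adj) (c , c-proper) = injective⇒≤ colour-inj
    where
    colour-inj : Injective _≡_ _≡_ (λ (i : Fin k) → c (f i) (f∈T i))
    colour-inj {i} {j} eq with i ≟F j
    ... | yes i≡j = i≡j
    ... | no  i≢j = ⊥-elim (c-proper _ _ _ _ (f-adj i j i≢j) eq)

  Colouring-mono : ∀ {T m m′} → m ≤ m′ → Colouring G T m → Colouring G T m′
  Colouring-mono m≤m′ (c , c-proper) =
    (λ u u∈ → inject≤ (c u u∈) m≤m′) ,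
    (λ u w u∈ w∈ adj eq → c-proper u w u∈ w∈ adj (inject≤-injective m≤m′ m≤m′ _ _ eq))

  colouring-of-empty : ∀ {T} → (∀ m → HasClique G T m → m ≤ 0) → Colouring G T 0
  colouring-of-empty {T} ω≤0 = (λ u u∈ → ⊥-elim (∉T u u∈)) , (λ u _ u∈ → ⊥-elim (∉T u u∈))
    where
    ∉T : ∀ u → ¬ u ∈ T
    ∉T u u∈ with ω≤0 1 (singleton-clique {T} u∈)
    ... | ()

  -- Injective, so proper whatever the edges are.
  index-colouring : ∀ T → Colouring G T (length (members T))
  index-colouring T = colour , proper
    where
    colour : ∀ u → u ∈ T → Fin (length (members T))
    colour u u∈ = Any.index (∈-members⁺ {T = T} u∈)
    proper : ∀ u w (u∈ : u ∈ T) (w∈ : w ∈ T) → Adj G u w → colour u u∈ ≢ colour w w∈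
    proper u w u∈ w∈ adj eq = irrefl G (subst (Adj G u) (sym u≡w) adj)
      where
      u≡w : u ≡ w
      u≡w = trans (lookup-index (∈-members⁺ {T = T} u∈))
                  (trans (cong (lookup (members T)) eq)
                         (sym (lookup-index (∈-members⁺ {T = T} w∈))))

  IsCompleteSet : VSet n → Set
  IsCompleteSet T = ∀ u w → u ∈ T → w ∈ T → u ≢ w → Adj G u w

  complete-members-clique : ∀ {T} → IsCompleteSet T → HasClique G T (length (members T))
  complete-members-clique {T} complete =
    lookup (members T) , lookup-injective (members-unique T) , member∈T , adj
    where
    member∈T : ∀ i → lookup (members T) i ∈ T
    member∈T i = ∈-members⁻ {T = T} (∈-lookup i)
    adj : ∀ i j → i ≢ j → Adj G (lookup (members T) i) (lookup (members T) j)
    adj i j i≢j = complete _ _ (member∈T i) (member∈T j)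
                    (λ eq → i≢j (lookup-injective (members-unique T) eq))

  complete-colouring : ∀ {T k} → IsCompleteSet T → (∀ m → HasClique G T m → m ≤ k) →
                       Colouring G T k
  complete-colouring {T} complete ω≤k =
    Colouring-mono (ω≤k _ (complete-members-clique complete)) (index-colouring T)

  colouring-add-isolated : ∀ {T v m} → (∀ u → u ∈ T → ¬ Adj G v u) →
                           Colouring G (T ∖ v) (suc m) → Colouring G T (suc m)
  colouring-add-isolated {T} {v} {m} isolated (c , c-proper) =
    (λ u u∈ → colour u u∈ (u ≟F v)) ,
    (λ u w u∈ w∈ → proper u w u∈ w∈ (u ≟F v) (w ≟F v))
    where
    colour : ∀ u → u ∈ T → Dec (u ≡ v) → Fin (suc m)
    colour u u∈ (yes _)   = zero
    colour u u∈ (no  u≢v) = c u (∈-∖⁺ {T = T} u∈ u≢v)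
    proper : ∀ u w (u∈ : u ∈ T) (w∈ : w ∈ T) du dw →
             Adj G u w → colour u u∈ du ≢ colour w w∈ dw
    proper u w u∈ w∈ (yes refl) _          adj _  = isolated w w∈ adj
    proper u w u∈ w∈ (no _)     (yes refl) adj _  = isolated u u∈ (Graph.sym G adj)
    proper u w u∈ w∈ (no _)     (no _)     adj eq = c-proper u w _ _ adj eq

  χ≤ω⇒Perfect : ∀ {S} → (∀ T → T ⊆ S → ∀ k → IsCliqueNumber G T k → Colouring G T k) →
                Perfect G S
  χ≤ω⇒Perfect colourable T T⊆S k ω@(clique , _) =
    colourable T T⊆S k ω , λ m → clique≤colours clique

  no-independent-triple : IndependenceNumber≤ G 2 → ∀ {u v w} → Unique (u ∷ v ∷ w ∷ []) →
                          ¬ Adj G u v → ¬ Adj G u w → ¬ Adj G v w → ⊥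
  no-independent-triple α≤2 {u} {v} {w} distinct ¬uv ¬uw ¬vw =
    3≰2 (α≤2 3 (lookup (u ∷ v ∷ w ∷ [])) (lookup-injective distinct , non-adjacent))
    where
    3≰2 : ¬ 3 ≤ 2
    3≰2 (s≤s (s≤s ()))
    non-adjacent : ∀ i j → ¬ Adj G (lookup (u ∷ v ∷ w ∷ []) i) (lookup (u ∷ v ∷ w ∷ []) j)
    non-adjacent zero             zero             = irrefl G
    non-adjacent zero             (suc zero)       = ¬uv
    non-adjacent zero             (suc (suc zero)) = ¬uw
    non-adjacent (suc zero)       zero             = λ vu → ¬uv (Graph.sym G vu)
    non-adjacent (suc zero)       (suc zero)       = irrefl G
    non-adjacent (suc zero)       (suc (suc zero)) = ¬vw
    non-adjacent (suc (suc zero)) zero             = λ wu → ¬uw (Graph.sym G wu)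
    non-adjacent (suc (suc zero)) (suc zero)       = λ wv → ¬vw (Graph.sym G wv)
    non-adjacent (suc (suc zero)) (suc (suc zero)) = irrefl G

  non-neighbours-adjacent : IndependenceNumber≤ G 2 → ∀ {v u w} → u ≢ v → w ≢ v → u ≢ w →
                            ¬ Adj G v u → ¬ Adj G v w → Adj G u w
  non-neighbours-adjacent α≤2 {v} {u} {w} u≢v w≢v u≢w ¬vu ¬vw with adj? G u w
  ... | yes uw = uw
  ... | no ¬uw = ⊥-elim (no-independent-triple α≤2 distinct ¬vu ¬vw ¬uw)
    where
    distinct : Unique (v ∷ u ∷ w ∷ [])
    distinct = ((λ v≡u → u≢v (sym v≡u)) ∷ (λ v≡w → w≢v (sym v≡w)) ∷ []) ∷ (u≢w ∷ []) ∷ [] ∷ []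

  NonNeighbour : Fin n → VSet n
  NonNeighbour v u = not ⌊ adj? G v u ⌋

  ∈-NonNeighbour⁻ : ∀ (S : VSet n) v u → u ∈ (λ w → S w ∧ NonNeighbour v w) → ¬ Adj G v u
  ∈-NonNeighbour⁻ S v u u∈ with S u | adj? G v u | u∈
  ... | true  | no ¬vu | _  = ¬vu
  ... | true  | yes _  | ()
  ... | false | _      | ()

  ∈-Neighbour⁻ : ∀ (S : VSet n) v u → u ∈ (λ w → S w ∧ not (NonNeighbour v w)) →
                 u ∈ S × Adj G v u
  ∈-Neighbour⁻ S v u u∈ with S u | adj? G v u | u∈
  ... | true  | yes vu | _  = refl , vu
  ... | true  | no _   | ()
  ... | false | _      | ()

  non-neighbours-perfect : IndependenceNumber≤ G 2 → ∀ (S : VSet n) v →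
                           Perfect G (λ u → S u ∧ NonNeighbour v u)
  non-neighbours-perfect α≤2 S v = χ≤ω⇒Perfect colourable
    where
    colourable : ∀ T → T ⊆ (λ u → S u ∧ NonNeighbour v u) →
                 ∀ k → IsCliqueNumber G T k → Colouring G T k
    colourable T T⊆A zero    (_ , ω≤0) = colouring-of-empty ω≤0
    colourable T T⊆A (suc m) (_ , ω≤k) =
      colouring-add-isolated isolated
        (complete-colouring complete (λ j clique → ω≤k j (HasClique-mono (∖-⊆ T v) clique)))
      where
      isolated : ∀ u → u ∈ T → ¬ Adj G v u
      isolated u u∈ = ∈-NonNeighbour⁻ S v u (T⊆A u u∈)
      complete : IsCompleteSet (T ∖ v)
      complete u w u∈ w∈ u≢w =
        non-neighbours-adjacent α≤2 (∈-∖⁻ {T = T} u∈) (∈-∖⁻ {T = T} w∈) u≢w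
          (isolated u (∖-⊆ T v u u∈)) (isolated w (∖-⊆ T v w w∈))

lemma2p4 : ∀ (n : ℕ) (G : Graph n) → IndependenceNumber≤ G 2 → PerfectlyDivisible G
lemma2p4 n G α≤2 S (v , v∈S) =
  NonNeighbour G v , non-neighbours-perfect G α≤2 S v , ω-neighbours<ω
  where
  ω-neighbours<ω : ∀ a b → IsCliqueNumber G (λ u → S u ∧ not (NonNeighbour G v u)) a →
                   IsCliqueNumber G S b → a < b
  ω-neighbours<ω a b (clique , _) (_ , ω≤b) =
    ω≤b (suc a) (extend-clique G v∈S (∈-Neighbour⁻ G S v) clique)
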